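{- Let $(G,+)$ be a commutative Moufang loop and let $k$ be a nuclear automorphism of $(G,+)$ such that $I-k$ is also an automorphism of $(G,+)$. Then: (S) $\mathrm{Aff}(G,k)$ is a Steiner quasigroup if and only if $G$ has exponent $3$ (i.e. $x+x+x=0$ for all $x\in G$) and $k=-I$; (M) $\mathrm{Aff}(G,k)$ is a Mendelsohn quasigroup if and only if $k-k^2=I$, i.e. $k(x)-k(k(x))=x$ for all $x\in G$.
   Context: A commutative Moufang loop $(G,+)$ is a commutative quasigroup with an identity element $0$ satisfying $(x+x)+(y+z)=(x+y)+(x+z)$ for all $x,y,z\in G$; such loops are diassociative, so expressions in two elements (such as $x+x+x$ or $-x$) are well defined. The nucleus of $G$ is the set of elements that associate with all elements of $G$. An automorphism $k$ of $(G,+)$ is nuclear if $x+k(x)$ lies in the nucleus for all $x\in G$. $I$ denotes the identity map, and $I-k$, $k-k^2$, $-I$ denote the maps $x\mapsto x-k(x)$, $x\mapsto k(x)-k(k(x))$, $x\mapsto -x$. $\mathrm{Aff}(G,k)$ is the quasigroup $(G,*_k)$ with $x*_k y=(I-k)(x)+k(y)$. A Steiner quasigroup is an idempotent quasigroup $(V,\circ)$ with $x\circ y=y\circ x$ and $x\circ(y\circ x)=y$ for all $x,y$. A Mendelsohn quasigroup is an idempotent quasigroup $(V,\circ)$ with $x\circ(y\circ x)=y$ for all $x,y$. -}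

module Defs where

open import Level using (Level; suc)
open import Data.Product using (Σ; _×_; _,_; proj₁)
open import Relation.Binary.PropositionalEquality using (_≡_)
open import Function.Definitions using (Injective; Surjective)

record IsQuasigroupOp {a : Level} {A : Set a} (_∘_ : A → A → A) : Set a where
  field
    leftSolve  : ∀ p q → Σ A (λ x → (p ∘ x ≡ q) × (∀ x′ → p ∘ x′ ≡ q → x′ ≡ x))
    rightSolve : ∀ p q → Σ A (λ y → (y ∘ p ≡ q) × (∀ y′ → y′ ∘ p ≡ q → y′ ≡ y))

record CML (a : Level) : Set (suc a) where
  infixl 6 _+_
  field
    Carrier     : Set a
    _+_         : Carrier → Carrier → Carrier
    0#          : Carrier
    isQuasigroup : IsQuasigroupOp _+_
    comm        : ∀ x y → x + y ≡ y + x
    identityˡ   : ∀ x → 0# + x ≡ x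
    identityʳ   : ∀ x → x + 0# ≡ x
    moufang     : ∀ x y z → (x + x) + (y + z) ≡ (x + y) + (x + z)

  -_ : Carrier → Carrier
  - x = proj₁ (IsQuasigroupOp.leftSolve isQuasigroup x 0#)

  infixl 6 _-_
  _-_ : Carrier → Carrier → Carrier
  x - y = x + (- y)

  InNucleus : Carrier → Set a
  InNucleus n = (∀ x y → (n + x) + y ≡ n + (x + y))
              × (∀ x y → (x + n) + y ≡ x + (n + y))
              × (∀ x y → (x + y) + n ≡ x + (y + n))

  IsAutomorphism : (Carrier → Carrier) → Set a
  IsAutomorphism k = (∀ x y → k (x + y) ≡ k x + k y)
                   × Injective _≡_ _≡_ k × Surjective _≡_ _≡_ k

  IsNuclear : (Carrier → Carrier) → Set a
  IsNuclear k = IsAutomorphism k × (∀ x → InNucleus (x + k x))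

  IminusK : (Carrier → Carrier) → Carrier → Carrier
  IminusK k x = x - k x

  Aff : (Carrier → Carrier) → Carrier → Carrier → Carrier
  Aff k x y = IminusK k x + k y

  HasExponent3 : Set a
  HasExponent3 = ∀ x → (x + x) + x ≡ 0#

IsSteiner : {a : Level} {A : Set a} → (A → A → A) → Set a
IsSteiner {A = A} _∘_ = IsQuasigroupOp _∘_ × (∀ x → x ∘ x ≡ x)
  × (∀ x y → x ∘ y ≡ y ∘ x) × (∀ x y → x ∘ (y ∘ x) ≡ y)

IsMendelsohn : {a : Level} {A : Set a} → (A → A → A) → Set a
IsMendelsohn {A = A} _∘_ = IsQuasigroupOp _∘_ × (∀ x → x ∘ x ≡ x)
  × (∀ x y → x ∘ (y ∘ x) ≡ y)

-- Aff(G,k) is always idempotent and, since k and I − k are bijective, a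
-- quasigroup. Evaluating at 0 shows that the Mendelsohn law
-- x ∘ (y ∘ x) = y amounts to k ∘ (I − k) = I, i.e. k − k² = I, and that
-- commutativity amounts to I − k = k. Together these give k² = I and
-- x = k x + k x, hence k x = x + x and x = 4x, i.e. exponent 3 and k = −I.
module Submission where

open import Defs
open import Level using (Level)
open import Data.Product using (Σ; _×_; _,_; proj₁; proj₂)
open import Relation.Binary.PropositionalEquality
  using (_≡_; refl; sym; trans; cong; cong₂; module ≡-Reasoning)
open import Function.Bundles using (Equivalence; _⇔_; mk⇔)
open import Function.Definitions using (Bijective)

module CMLProperties {a : Level} (G : CML a) where
  open CML G
  open IsQuasigroupOp isQuasigroup
  open ≡-Reasoning

  +-cancelˡ : ∀ p {x y} → p + x ≡ p + y → x ≡ y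
  +-cancelˡ p {x} {y} e = trans (unique x e) (sym (unique y refl))
    where unique = proj₂ (proj₂ (leftSolve p (p + y)))

  -‿inverseʳ : ∀ x → x + (- x) ≡ 0#
  -‿inverseʳ x = proj₁ (proj₂ (leftSolve x 0#))

  -‿inverseˡ : ∀ x → (- x) + x ≡ 0#
  -‿inverseˡ x = trans (comm _ _) (-‿inverseʳ x)

  inverseʳ-unique : ∀ x y → x + y ≡ 0# → y ≡ - x
  inverseʳ-unique x y e = +-cancelˡ x (trans e (sym (-‿inverseʳ x)))

  -‿involutive : ∀ x → - (- x) ≡ x
  -‿involutive x = sym (inverseʳ-unique (- x) x (-‿inverseˡ x))

  alternativeˡ : ∀ x y → (x + x) + y ≡ x + (x + y)
  alternativeˡ x y = begin
    (x + x) + y        ≡⟨ cong ((x + x) +_) (sym (identityˡ y)) ⟩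
    (x + x) + (0# + y) ≡⟨ moufang x 0# y ⟩
    (x + 0#) + (x + y) ≡⟨ cong (_+ (x + y)) (identityʳ x) ⟩
    x + (x + y)        ∎

  inversePropertyˡ : ∀ x y → (- x) + (x + y) ≡ y
  inversePropertyˡ x y = +-cancelˡ (x + x) (begin
    (x + x) + ((- x) + (x + y)) ≡⟨ moufang x (- x) (x + y) ⟩
    (x + (- x)) + (x + (x + y)) ≡⟨ cong (_+ (x + (x + y))) (-‿inverseʳ x) ⟩
    0# + (x + (x + y))          ≡⟨ identityˡ _ ⟩
    x + (x + y)                 ≡⟨ sym (alternativeˡ x y) ⟩
    (x + x) + y                 ∎)

  inversePropertyʳ : ∀ x y → (x - y) + y ≡ x
  inversePropertyʳ x y = begin
    (x + (- y)) + y         ≡⟨ cong₂ _+_ (comm x (- y)) (sym (-‿involutive y)) ⟩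
    ((- y) + x) + (- (- y)) ≡⟨ comm _ _ ⟩
    (- (- y)) + ((- y) + x) ≡⟨ inversePropertyˡ (- y) x ⟩
    x                       ∎

  exponent3⇒double≡neg : ∀ x → (x + x) + x ≡ 0# → x + x ≡ - x
  exponent3⇒double≡neg x e = inverseʳ-unique x (x + x) (trans (comm _ _) e)

  IsEndomorphism : (Carrier → Carrier) → Set a
  IsEndomorphism f = ∀ x y → f (x + y) ≡ f x + f y

  module _ {f : Carrier → Carrier} (hom : IsEndomorphism f) where

    hom-0 : f 0# ≡ 0#
    hom-0 = +-cancelˡ (f 0#)
      (trans (sym (hom 0# 0#)) (trans (cong f (identityˡ 0#)) (sym (identityʳ _))))

    hom-neg : ∀ x → f (- x) ≡ - f x
    hom-neg x = inverseʳ-unique (f x) (f (- x))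
      (trans (sym (hom x (- x))) (trans (cong f (-‿inverseʳ x)) hom-0))

  +-solveˡ : ∀ {f : Carrier → Carrier} → Bijective _≡_ _≡_ f → ∀ p q →
             Σ Carrier (λ x → (p + f x ≡ q) × (∀ x′ → p + f x′ ≡ q → x′ ≡ x))
  +-solveˡ {f} (injective , surjective) p q
    with leftSolve p q | surjective (proj₁ (leftSolve p q))
  ... | c , p+c≡q , unique | x , fx≡c =
    x , trans (cong (p +_) (fx≡c refl)) p+c≡q ,
    λ x′ e → injective (trans (unique (f x′) e) (sym (fx≡c refl)))

  biaffine-isQuasigroupOp : ∀ {f g : Carrier → Carrier} →
    Bijective _≡_ _≡_ f → Bijective _≡_ _≡_ g → IsQuasigroupOp (λ x y → f x + g y)
  biaffine-isQuasigroupOp {f} {g} f-bij g-bij = record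
    { leftSolve  = λ p q → +-solveˡ g-bij (f p) q
    ; rightSolve = λ p q → solveʳ (+-solveˡ f-bij (g p) q)
    }
    where
    solveʳ : ∀ {p q} → Σ Carrier (λ y → (g p + f y ≡ q) × (∀ y′ → g p + f y′ ≡ q → y′ ≡ y))
           → Σ Carrier (λ y → (f y + g p ≡ q) × (∀ y′ → f y′ + g p ≡ q → y′ ≡ y))
    solveʳ (y , e , unique) = y , trans (comm _ _) e ,
      λ y′ e′ → unique y′ (trans (comm _ _) e′)

  Aff-isQuasigroupOp : ∀ k → IsAutomorphism k → IsAutomorphism (IminusK k) →
                       IsQuasigroupOp (Aff k)
  Aff-isQuasigroupOp k (_ , k-bij) (_ , I-k-bij) = biaffine-isQuasigroupOp I-k-bij k-bij

  Aff-idem : ∀ k x → Aff k x x ≡ x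
  Aff-idem k x = inversePropertyʳ x (k x)

  module _ {k : Carrier → Carrier} (hom : IsEndomorphism k) where

    IminusK-0 : IminusK k 0# ≡ 0#
    IminusK-0 = trans (cong (λ u → 0# - u) (hom-0 hom)) (-‿inverseʳ 0#)

    Aff-0ˡ : ∀ y → Aff k 0# y ≡ k y
    Aff-0ˡ y = trans (cong (_+ k y) IminusK-0) (identityˡ (k y))

    Aff-0ʳ : ∀ x → Aff k x 0# ≡ IminusK k x
    Aff-0ʳ x = trans (cong (IminusK k x +_) (hom-0 hom)) (identityʳ _)

    k∘IminusK : ∀ x → k (IminusK k x) ≡ k x - k (k x)
    k∘IminusK x = trans (hom x (- k x)) (cong (k x +_) (hom-neg hom (k x)))

    Aff-comm⇔IminusK≡k : (∀ x y → Aff k x y ≡ Aff k y x) ⇔ (∀ x → IminusK k x ≡ k x)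
    Aff-comm⇔IminusK≡k = mk⇔ to from
      where
      to : (∀ x y → Aff k x y ≡ Aff k y x) → ∀ x → IminusK k x ≡ k x
      to aff-comm x = trans (sym (Aff-0ʳ x)) (trans (aff-comm x 0#) (Aff-0ˡ x))

      from : (∀ x → IminusK k x ≡ k x) → ∀ x y → Aff k x y ≡ Aff k y x
      from I-k≡k x y = begin
        IminusK k x + k y ≡⟨ cong (_+ k y) (I-k≡k x) ⟩
        k x + k y         ≡⟨ comm _ _ ⟩
        k y + k x         ≡⟨ cong (_+ k x) (sym (I-k≡k y)) ⟩
        IminusK k y + k x ∎

    Aff-mendelsohn⇔k-k²≡I : (∀ x y → Aff k x (Aff k y x) ≡ y) ⇔ (∀ x → k x - k (k x) ≡ x)
    Aff-mendelsohn⇔k-k²≡I = mk⇔ to from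
      where
      to : (∀ x y → Aff k x (Aff k y x) ≡ y) → ∀ x → k x - k (k x) ≡ x
      to law y = begin
        k y - k (k y)          ≡⟨ sym (k∘IminusK y) ⟩
        k (IminusK k y)        ≡⟨ sym (trans (Aff-0ˡ _) (cong k (Aff-0ʳ y))) ⟩
        Aff k 0# (Aff k y 0#)  ≡⟨ law 0# y ⟩
        y                      ∎

      from : (∀ x → k x - k (k x) ≡ x) → ∀ x y → Aff k x (Aff k y x) ≡ y
      from k-k²≡I x y = begin
        IminusK k x + k (IminusK k y + k x)       ≡⟨ cong (IminusK k x +_) (hom _ _) ⟩
        IminusK k x + (k (IminusK k y) + k (k x)) ≡⟨ cong₂ (λ u v → IminusK k x + (u + v))
                                                       (trans (k∘IminusK y) (k-k²≡I y)) k²≡-[I-k] ⟩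
        IminusK k x + (y - IminusK k x)           ≡⟨ comm _ _ ⟩
        (y - IminusK k x) + IminusK k x           ≡⟨ inversePropertyʳ y _ ⟩
        y                                         ∎
        where
        k²≡-[I-k] : k (k x) ≡ - IminusK k x
        k²≡-[I-k] = begin
          k (k x)                     ≡⟨ sym (-‿involutive _) ⟩
          - (- k (k x))               ≡⟨ cong -_ (sym (inversePropertyˡ (k x) _)) ⟩
          - (- k x + (k x - k (k x))) ≡⟨ cong (λ u → - (- k x + u)) (k-k²≡I x) ⟩
          - (- k x + x)               ≡⟨ cong -_ (comm _ _) ⟩
          - IminusK k x               ∎

    commutative-mendelsohn⇔exponent3×k≡-I :
      ((∀ x → IminusK k x ≡ k x) × (∀ x → k x - k (k x) ≡ x))
      ⇔ (HasExponent3 × (∀ x → k x ≡ - x))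
    commutative-mendelsohn⇔exponent3×k≡-I = mk⇔ to from
      where
      to : (∀ x → IminusK k x ≡ k x) × (∀ x → k x - k (k x) ≡ x)
         → HasExponent3 × (∀ x → k x ≡ - x)
      to (I-k≡k , k-k²≡I) =
        exponent3 , λ x → trans (k≡double x) (exponent3⇒double≡neg x (exponent3 x))
        where
        k²≡I : ∀ x → k (k x) ≡ x
        k²≡I x = trans (cong k (sym (I-k≡k x))) (trans (k∘IminusK x) (k-k²≡I x))

        x≡double-k : ∀ x → x ≡ k x + k x
        x≡double-k x = trans (sym (inversePropertyʳ x (k x))) (cong (_+ k x) (I-k≡k x))

        k≡double : ∀ x → k x ≡ x + x
        k≡double x = trans (cong k (x≡double-k x)) (trans (hom _ _) (cong₂ _+_ (k²≡I x) (k²≡I x)))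

        exponent3 : HasExponent3
        exponent3 x = trans (comm _ _) (sym (+-cancelˡ x (begin
          x + 0#            ≡⟨ identityʳ x ⟩
          x                 ≡⟨ x≡double-k x ⟩
          k x + k x         ≡⟨ cong₂ _+_ (k≡double x) (k≡double x) ⟩
          (x + x) + (x + x) ≡⟨ alternativeˡ x (x + x) ⟩
          x + (x + (x + x)) ∎)))

      from : HasExponent3 × (∀ x → k x ≡ - x)
           → (∀ x → IminusK k x ≡ k x) × (∀ x → k x - k (k x) ≡ x)
      from (exponent3 , k≡-I) = I-k≡k , k-k²≡I
        where
        double≡neg : ∀ x → x + x ≡ - x
        double≡neg x = exponent3⇒double≡neg x (exponent3 x)

        k²≡I : ∀ x → k (k x) ≡ x
        k²≡I x = trans (k≡-I (k x)) (trans (cong -_ (k≡-I x)) (-‿involutive x))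

        I-k≡k : ∀ x → IminusK k x ≡ k x
        I-k≡k x = begin
          x - k x   ≡⟨ cong (λ u → x + - u) (k≡-I x) ⟩
          x - (- x) ≡⟨ cong (x +_) (-‿involutive x) ⟩
          x + x     ≡⟨ double≡neg x ⟩
          - x       ≡⟨ sym (k≡-I x) ⟩
          k x       ∎

        k-k²≡I : ∀ x → k x - k (k x) ≡ x
        k-k²≡I x = begin
          k x - k (k x) ≡⟨ cong₂ (λ u v → u + - v) (k≡-I x) (k²≡I x) ⟩
          - x + - x     ≡⟨ double≡neg (- x) ⟩
          - (- x)       ≡⟨ -‿involutive x ⟩
          x             ∎

proposition2p1 : ∀ {a : Level} (G : CML a) (k : CML.Carrier G → CML.Carrier G)
    → CML.IsNuclear G k → CML.IsAutomorphism G (CML.IminusK G k)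
    → (IsSteiner (CML.Aff G k) ⇔ (CML.HasExponent3 G × (∀ x → k x ≡ CML.-_ G x)))
    × (IsMendelsohn (CML.Aff G k) ⇔ (∀ x → CML._-_ G (k x) (k (k x)) ≡ x))
proposition2p1 G k (k-aut@(hom , _) , _) I-k-aut =
  mk⇔ steiner⇒ steiner⇐ , mk⇔ mendelsohn⇒ mendelsohn⇐
  where
  open CML G using (Aff; HasExponent3; -_; _-_)
  open CMLProperties G
  open Equivalence using (to; from)

  mendelsohn⇒ : IsMendelsohn (Aff k) → ∀ x → k x - k (k x) ≡ x
  mendelsohn⇒ (_ , _ , aff-law) = to (Aff-mendelsohn⇔k-k²≡I hom) aff-law

  mendelsohn⇐ : (∀ x → k x - k (k x) ≡ x) → IsMendelsohn (Aff k)
  mendelsohn⇐ k-k²≡I =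
    Aff-isQuasigroupOp k k-aut I-k-aut , Aff-idem k , from (Aff-mendelsohn⇔k-k²≡I hom) k-k²≡I

  steiner⇒ : IsSteiner (Aff k) → HasExponent3 × (∀ x → k x ≡ - x)
  steiner⇒ (_ , _ , aff-comm , aff-law) =
    to (commutative-mendelsohn⇔exponent3×k≡-I hom)
      (to (Aff-comm⇔IminusK≡k hom) aff-comm , to (Aff-mendelsohn⇔k-k²≡I hom) aff-law)

  steiner⇐ : HasExponent3 × (∀ x → k x ≡ - x) → IsSteiner (Aff k)
  steiner⇐ e3×k≡-I with from (commutative-mendelsohn⇔exponent3×k≡-I hom) e3×k≡-I
  ... | I-k≡k , k-k²≡I with mendelsohn⇐ k-k²≡I
  ...   | q , idem , aff-law = q , idem , from (Aff-comm⇔IminusK≡k hom) I-k≡k , aff-law
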